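{- (a) For every Turing machine $M$, $\zeta_M<\infty$ if and only if $\Omega_M<\infty$. (b) For every Turing machine $M$, if $\Omega_M\le 1$ then $\zeta_M\le 1$; moreover there exists a tuatara machine $T$ with $\Omega_T>1$.
   Context: Turing machines map binary strings to binary strings (partial functions on $\Sigma^*$, $\Sigma=\{0,1\}$); $\mathrm{dom}(M)$ is the set of inputs on which $M$ halts. $\mathrm{bin}:\mathbf{N}=\{1,2,\dots\}\to\Sigma^*$ is the bijection sending $n$ to its binary expansion with the leading 1 removed. For a Turing machine $M$: $\Omega_M=\sum_{p\in\mathrm{dom}(M)}2^{ -|p|}$ (possibly $\infty$) and $\zeta_M=\sum_{n\ge1,\ \mathrm{bin}(n)\in\mathrm{dom}(M)}\frac1n$ (possibly $\infty$). $M$ is a tuatara machine if $\zeta_M\le 1$. -}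

module Defs where

open import Data.Nat as ℕ using (ℕ; zero; suc; _≤ᵇ_; _/_; _%_)
open import Data.Bool using (Bool; true; false; if_then_else_)
open import Data.Fin using (Fin)
open import Data.List using (List; []; _∷_; _++_; map; length; foldr)
open import Data.Maybe using (Maybe; just; nothing)
open import Data.Product using (_×_; _,_; ∃; Σ)
open import Data.Integer using (+_)
open import Data.Rational as Q using (ℚ; 0ℚ; 1ℚ; ½)
open import Data.List.Relation.Unary.All using (All)
open import Data.List.Relation.Unary.Unique.Propositional using (Unique)
open import Relation.Binary.PropositionalEquality using (_≡_)

-- Binary strings: Σ* = List Bool  (false = 0, true = 1)

Str : Set
Str = List Bool

-- Turing machines (single tape, tape alphabet {blank,0,1}).
-- The machine halts when δ is undefined (nothing) on the current
-- (state, scanned symbol).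

data Sym : Set where
  blank b0 b1 : Sym

data Move : Set where
  L R : Move

record TM : Set where
  field
    states : ℕ
    start  : Fin states
    δ      : Fin states → Sym → Maybe (Fin states × Sym × Move)

record Config (M : TM) : Set where
  constructor cfg
  field
    state : Fin (TM.states M)
    left  : List Sym   -- cells to the left of the head, nearest first
    head  : Sym
    right : List Sym   -- cells to the right of the head, nearest first

bitSym : Bool → Sym
bitSym false = b0
bitSym true  = b1

initCfg : (M : TM) → Str → Config M
initCfg M []      = cfg (TM.start M) [] blank []
initCfg M (b ∷ p) = cfg (TM.start M) [] (bitSym b) (map bitSym p)

moveHead : Move → List Sym → Sym → List Sym → List Sym × Sym × List Sym
moveHead L []      h r       = [] , blank , h ∷ r
moveHead L (x ∷ l) h r       = l , x , h ∷ r
moveHead R l       h []      = h ∷ l , blank , []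
moveHead R l       h (x ∷ r) = h ∷ l , x , r

step : (M : TM) → Config M → Config M
step M c@(cfg q l h r) with TM.δ M q h
... | nothing = c
... | just (q' , s , m) with moveHead m l s r
...   | l' , h' , r' = cfg q' l' h' r'

run : (M : TM) → ℕ → Config M → Config M
run M zero    c = c
run M (suc k) c = run M k (step M c)

isHalted : (M : TM) → Config M → Set
isHalted M c = TM.δ M (Config.state c) (Config.head c) ≡ nothing

Halts : TM → Str → Set
Halts M p = ∃ λ k → isHalted M (run M k (initCfg M p))

-- bin : N = {1,2,...} → Σ*, binary expansion with the leading 1 removed.
-- (computed with fuel; fuel n is always enough; bin 0 = [] is irrelevant
-- since only n ≥ 1 are ever used)

binF : ℕ → ℕ → Str
binF zero    n = []
binF (suc f) n =
  if n ≤ᵇ 1 then [] else (binF f (n / 2) ++ (if (n % 2) ≤ᵇ 0 then false ∷ [] else true ∷ []))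

bin : ℕ → Str
bin n = binF n n

pow½ : ℕ → ℚ
pow½ zero    = 1ℚ
pow½ (suc k) = ½ Q.* pow½ k

-- 1/n  (for n ≥ 1; the value at 0 is never used)
inv : ℕ → ℚ
inv zero    = 0ℚ
inv (suc m) = (+ 1) Q./ (suc m)

sumℚ : List ℚ → ℚ
sumℚ = foldr Q._+_ 0ℚ

-- Ω_M and ζ_M are sums of non-negative terms, i.e. suprema of their
-- finite partial sums.  We express them through finite partial sums.

ΩPartial : TM → List Str → Set
ΩPartial M xs = Unique xs × All (Halts M) xs

ΩSum : List Str → ℚ
ΩSum xs = sumℚ (map (λ p → pow½ (length p)) xs)

Ω≤ : TM → ℚ → Set
Ω≤ M q = ∀ xs → ΩPartial M xs → ΩSum xs Q.≤ q

Ω> : TM → ℚ → Set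
Ω> M q = Σ (List Str) λ xs → ΩPartial M xs × q Q.< ΩSum xs

ΩFinite : TM → Set
ΩFinite M = Σ ℚ λ q → Ω≤ M q

ζPartial : TM → List ℕ → Set
ζPartial M ns = Unique ns × All (λ n → (1 ℕ.≤ n) × Halts M (bin n)) ns

ζSum : List ℕ → ℚ
ζSum ns = sumℚ (map inv ns)

ζ≤ : TM → ℚ → Set
ζ≤ M q = ∀ ns → ζPartial M ns → ζSum ns Q.≤ q

ζFinite : TM → Set
ζFinite M = Σ ℚ λ q → ζ≤ M q

Tuatara : TM → Set
Tuatara M = ζ≤ M 1ℚ

{-# OPTIONS --safe #-}
-- With k = |bin n| one has 2^k ≤ n < 2^(k+1), i.e. 2^-(k+1) < 1/n ≤ 2^-k.  Since bin is a
-- bijection between positive integers and strings, it turns every term of ζ_M into at most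
-- the matching term of Ω_M, and every term of Ω_M into at most twice the matching term of
-- ζ_M; hence ζ_M ≤ Ω_M ≤ 2 ζ_M.  A machine halting exactly on 0, 1 and 10 = bin 2, bin 3,
-- bin 6 has ζ = 1/2 + 1/3 + 1/6 = 1 but Ω = 1/2 + 1/2 + 1/4 = 5/4.
module Submission where

open import Defs

open import Algebra.Bundles using (CommutativeMonoid)
open import Data.Bool using (Bool; true; false; if_then_else_)
open import Data.Empty using (⊥-elim)
open import Data.Fin using (Fin; zero; suc)
open import Data.Integer as ℤ using (+_)
import Data.Integer.GCD as ℤ
import Data.Integer.Properties as ℤ
open import Data.List using (List; []; _∷_; _++_; _∷ʳ_; map; length; foldl)
open import Data.List.Membership.Propositional using (_∈_)
open import Data.List.Membership.Propositional.Properties using (∈-map⁺)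
open import Data.List.Properties using (foldl-∷ʳ; ++-assoc; ++-identityʳ; map-∘; map-id-local)
open import Data.List.Relation.Unary.All as All using (All; []; _∷_)
import Data.List.Relation.Unary.All.Properties as All
open import Data.List.Relation.Unary.AllPairs using ([]; _∷_)
open import Data.List.Relation.Unary.Any using (here; there; _─_)
open import Data.List.Relation.Unary.Unique.Propositional using (Unique)
import Data.List.Relation.Unary.Unique.Propositional.Properties as Unique
open import Data.Maybe using (Maybe; just; nothing)
open import Data.Nat as ℕ using (ℕ; zero; suc; _≤_; _<_; _^_; _≤ᵇ_; z≤n; s≤s)
open import Data.Nat.DivMod
  using (_/_; _%_; m≡m%n+[m/n]*n; m%n<n; m*n/n≡m; m*n%n≡0; [m+kn]%n≡m%n; +-distrib-/; m/n<m; m≥n⇒m/n>0)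
open import Data.Nat.Induction using (<-wellFounded)
import Data.Nat.Properties as ℕ
open import Data.Product using (_×_; Σ; ∃; _,_; proj₁; proj₂)
open import Data.Rational as ℚ using (ℚ; 0ℚ; 1ℚ; ½; ↥_; ↧_; _+_; _*_)
import Data.Rational.Properties as ℚ
open import Algebra.Properties.CommutativeSemigroup
  (CommutativeMonoid.commutativeSemigroup ℚ.+-0-commutativeMonoid) using (interchange; x∙yz≈y∙xz)
open import Function using (_∘_)
open import Induction.WellFounded using (Acc; acc)
open import Relation.Binary.PropositionalEquality
open import Relation.Nullary using (¬_)
open import Relation.Nullary.Decidable using (toWitness)

Reciprocal : ℕ → ℚ → Set
Reciprocal d q = ↥ q ≡ + 1 × ↧ q ≡ + d

reciprocal-1/ : ∀ d .{{_ : ℕ.NonZero d}} → Reciprocal d (+ 1 ℚ./ d)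
reciprocal-1/ d = cancel-gcd (ℚ.↥-/ (+ 1) d) , cancel-gcd (ℚ.↧-/ (+ 1) d)
  where
  cancel-gcd : ∀ {i j} → i ℤ.* ℤ.gcd (+ 1) (+ d) ≡ j → i ≡ j
  cancel-gcd {i} eq = trans (sym (ℤ.*-identityʳ i)) (trans (cong (i ℤ.*_) (sym (ℤ.gcd-zeroˡ (+ d)))) eq)

reciprocal-½* : ∀ {d} q → Reciprocal d q → Reciprocal (2 ℕ.* d) (½ * q)
reciprocal-½* (ℚ.mkℚ _ d-1 _) (refl , refl) = reciprocal-1/ (2 ℕ.* suc d-1)

reciprocal-pow½ : ∀ k → Reciprocal (2 ^ k) (pow½ k)
reciprocal-pow½ zero    = refl , refl
reciprocal-pow½ (suc k) = reciprocal-½* (pow½ k) (reciprocal-pow½ k)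

reciprocal-antitone : ∀ {a b p q} → Reciprocal a p → Reciprocal b q → b ≤ a → p ℚ.≤ q
reciprocal-antitone {a} {b} {p} {q} (↥p , ↧p) (↥q , ↧q) b≤a = ℚ.*≤* (begin
  ↥ p ℤ.* ↧ q ≡⟨ cong₂ ℤ._*_ ↥p ↧q ⟩
  + 1 ℤ.* + b ≡⟨ ℤ.*-identityˡ (+ b) ⟩
  + b         ≤⟨ ℤ.+≤+ b≤a ⟩
  + a         ≡⟨ sym (ℤ.*-identityˡ (+ a)) ⟩
  + 1 ℤ.* + a ≡⟨ cong₂ ℤ._*_ (sym ↥q) (sym ↧p) ⟩
  ↥ q ℤ.* ↧ p ∎)
  where open ℤ.≤-Reasoning

inv≤pow½ : ∀ n k → 2 ^ k ≤ n → inv n ℚ.≤ pow½ k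
inv≤pow½ zero    k 2^k≤0 = ⊥-elim (ℕ.<⇒≱ (ℕ.m^n>0 2 k) 2^k≤0)
inv≤pow½ (suc m) k 2^k≤n = reciprocal-antitone (reciprocal-1/ (suc m)) (reciprocal-pow½ k) 2^k≤n

pow½≤inv : ∀ n k → 1 ≤ n → n ≤ 2 ^ k → pow½ k ℚ.≤ inv n
pow½≤inv (suc m) k _ n≤2^k = reciprocal-antitone (reciprocal-pow½ k) (reciprocal-1/ (suc m)) n≤2^k

pow½-halve : ∀ k → pow½ k ≡ pow½ (suc k) + pow½ (suc k)
pow½-halve k = begin
  pow½ k                    ≡⟨ ℚ.*-identityˡ (pow½ k) ⟨
  (½ + ½) * pow½ k          ≡⟨ ℚ.*-distribʳ-+ (pow½ k) ½ ½ ⟩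
  ½ * pow½ k + ½ * pow½ k   ∎
  where open ≡-Reasoning

inv-nonNegative : ∀ n → 0ℚ ℚ.≤ inv n
inv-nonNegative zero    = ℚ.≤-refl
inv-nonNegative (suc m) = ℚ.nonNegative⁻¹ (inv (suc m)) {{ℚ.normalize-nonNeg 1 (suc m)}}

module _ {A : Set} where

  sumℚ-map-mono : ∀ {f g : A → ℚ} {xs} → All (λ x → f x ℚ.≤ g x) xs →
                  sumℚ (map f xs) ℚ.≤ sumℚ (map g xs)
  sumℚ-map-mono []         = ℚ.≤-refl
  sumℚ-map-mono (fx≤gx ∷ ps) = ℚ.+-mono-≤ fx≤gx (sumℚ-map-mono ps)

  sumℚ-map-+ : ∀ (f g : A → ℚ) xs →
               sumℚ (map (λ x → f x + g x) xs) ≡ sumℚ (map f xs) + sumℚ (map g xs)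
  sumℚ-map-+ f g []       = refl
  sumℚ-map-+ f g (x ∷ xs) = trans (cong (_+_ (f x + g x)) (sumℚ-map-+ f g xs))
                                  (interchange (f x) (g x) _ _)

  sumℚ-map-nonNegative : ∀ {f : A → ℚ} → (∀ x → 0ℚ ℚ.≤ f x) → ∀ xs → 0ℚ ℚ.≤ sumℚ (map f xs)
  sumℚ-map-nonNegative f≥0 []       = ℚ.≤-refl
  sumℚ-map-nonNegative f≥0 (x ∷ xs) = ℚ.+-mono-≤ (f≥0 x) (sumℚ-map-nonNegative f≥0 xs)

  sumℚ-map-─ : ∀ (f : A → ℚ) {x} ys (x∈ys : x ∈ ys) →
               sumℚ (map f ys) ≡ f x + sumℚ (map f (ys ─ x∈ys))
  sumℚ-map-─ f (y ∷ ys) (here refl)  = refl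
  sumℚ-map-─ f (y ∷ ys) (there x∈ys) =
    trans (cong (_+_ (f y)) (sumℚ-map-─ f ys x∈ys)) (x∙yz≈y∙xz (f y) (f _) _)

  ∈-─ : ∀ {x y : A} {ys} (x∈ys : x ∈ ys) → y ∈ ys → x ≢ y → y ∈ (ys ─ x∈ys)
  ∈-─ (here refl)  (here refl)  x≢y = ⊥-elim (x≢y refl)
  ∈-─ (here refl)  (there y∈ys) _   = y∈ys
  ∈-─ (there x∈ys) (here y≡z)   _   = here y≡z
  ∈-─ (there x∈ys) (there y∈ys) x≢y = there (∈-─ x∈ys y∈ys x≢y)

  sumℚ-map-⊆ : ∀ {f : A → ℚ} → (∀ x → 0ℚ ℚ.≤ f x) → ∀ {xs ys} →
               Unique xs → All (_∈ ys) xs → sumℚ (map f xs) ℚ.≤ sumℚ (map f ys)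
  sumℚ-map-⊆ f≥0 {[]} {ys}        _             _             = sumℚ-map-nonNegative f≥0 ys
  sumℚ-map-⊆ {f} f≥0 {x ∷ xs} {ys} (x∉xs ∷ xs!) (x∈ys ∷ xs⊆ys) = begin
    f x + sumℚ (map f xs)              ≤⟨ ℚ.+-monoʳ-≤ (f x) (sumℚ-map-⊆ f≥0 xs! xs⊆ys─x) ⟩
    f x + sumℚ (map f (ys ─ x∈ys))     ≡⟨ sym (sumℚ-map-─ f ys x∈ys) ⟩
    sumℚ (map f ys)                    ∎
    where
    open ℚ.≤-Reasoning
    xs⊆ys─x : All (_∈ (ys ─ x∈ys)) xs
    xs⊆ys─x = All.zipWith (λ (y∈ys , x≢y) → ∈-─ x∈ys y∈ys x≢y) (xs⊆ys , x∉xs)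

binF-fuel : ∀ f g n → n ≤ f → n ≤ g → binF f n ≡ binF g n
binF-fuel zero    zero    zero          _       _       = refl
binF-fuel zero    (suc g) zero          _       _       = refl
binF-fuel (suc f) zero    zero          _       _       = refl
binF-fuel (suc f) (suc g) zero          _       _       = refl
binF-fuel (suc f) (suc g) (suc zero)    _       _       = refl
binF-fuel (suc f) (suc g) (suc (suc m)) (s≤s n≤f) (s≤s n≤g) =
  cong (_++ _) (binF-fuel f g (n / 2) (ℕ.≤-trans n/2≤1+m n≤f) (ℕ.≤-trans n/2≤1+m n≤g))
  where
  n = suc (suc m)
  n/2≤1+m : n / 2 ≤ suc m
  n/2≤1+m = ℕ.<⇒≤pred (m/n<m n 2 ℕ.≤-refl)

lastDigit : ℕ → Str
lastDigit n = if n % 2 ≤ᵇ 0 then false ∷ [] else true ∷ []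

bin-unfold : ∀ {n} → 2 ≤ n → bin n ≡ bin (n / 2) ++ lastDigit n
bin-unfold {suc (suc m)} (s≤s (s≤s _)) =
  cong (_++ lastDigit n) (binF-fuel (suc m) (n / 2) (n / 2) (ℕ.<⇒≤pred (m/n<m n 2 ℕ.≤-refl)) ℕ.≤-refl)
  where n = suc (suc m)

pushBit : ℕ → Bool → ℕ
pushBit n false = n ℕ.* 2
pushBit n true  = suc (n ℕ.* 2)

-- the accumulator starts at 1, the leading digit that bin drops
fromBin : Str → ℕ
fromBin = foldl pushBit 1

pushBit-/2 : ∀ n b → pushBit n b / 2 ≡ n
pushBit-/2 n false = m*n/n≡m n 2
pushBit-/2 n true  = trans (+-distrib-/ 1 (n ℕ.* 2) no-carry) (m*n/n≡m n 2)
  where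
  no-carry : 1 ℕ.+ n ℕ.* 2 % 2 < 2
  no-carry = subst (λ r → 1 ℕ.+ r < 2) (sym (m*n%n≡0 n 2)) ℕ.≤-refl

lastDigit-pushBit : ∀ n b → lastDigit (pushBit n b) ≡ b ∷ []
lastDigit-pushBit n false rewrite m*n%n≡0 n 2 {{_}} = refl
lastDigit-pushBit n true  rewrite [m+kn]%n≡m%n 1 n 2 {{_}} = refl

pushBit-half : ∀ n → ∃ λ b → pushBit (n / 2) b ≡ n
pushBit-half n with n % 2 | m%n<n n 2 | m≡m%n+[m/n]*n n 2
... | 0           | _            | n≡2[n/2]   = false , sym n≡2[n/2]
... | 1           | _            | n≡1+2[n/2] = true , sym n≡1+2[n/2]
... | suc (suc _) | s≤s (s≤s ()) | _

*2≤pushBit : ∀ n b → n ℕ.* 2 ≤ pushBit n b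
*2≤pushBit n false = ℕ.≤-refl
*2≤pushBit n true  = ℕ.n≤1+n _

pushBit<*2 : ∀ n b → pushBit n b < suc n ℕ.* 2
pushBit<*2 n false = ℕ.n≤1+n _
pushBit<*2 n true  = ℕ.≤-refl

2≤pushBit : ∀ {n} b → 1 ≤ n → 2 ≤ pushBit n b
2≤pushBit {n} b 1≤n = ℕ.≤-trans (ℕ.*-monoˡ-≤ 2 1≤n) (*2≤pushBit n b)

bin-pushBit : ∀ {n} b → 1 ≤ n → bin (pushBit n b) ≡ bin n ∷ʳ b
bin-pushBit {n} b 1≤n = begin
  bin (pushBit n b)
    ≡⟨ bin-unfold (2≤pushBit b 1≤n) ⟩
  bin (pushBit n b / 2) ++ lastDigit (pushBit n b)
    ≡⟨ cong₂ _++_ (cong bin (pushBit-/2 n b)) (lastDigit-pushBit n b) ⟩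
  bin n ∷ʳ b ∎
  where open ≡-Reasoning

bin-foldl-pushBit : ∀ {n} p → 1 ≤ n → bin (foldl pushBit n p) ≡ bin n ++ p
bin-foldl-pushBit {n} []      _   = sym (++-identityʳ (bin n))
bin-foldl-pushBit {n} (b ∷ p) 1≤n = begin
  bin (foldl pushBit (pushBit n b) p) ≡⟨ bin-foldl-pushBit p (ℕ.≤-trans (s≤s z≤n) (2≤pushBit b 1≤n)) ⟩
  bin (pushBit n b) ++ p              ≡⟨ cong (_++ p) (bin-pushBit b 1≤n) ⟩
  (bin n ∷ʳ b) ++ p                   ≡⟨ ++-assoc (bin n) (b ∷ []) p ⟩
  bin n ++ b ∷ p                      ∎
  where open ≡-Reasoning

bin-fromBin : ∀ p → bin (fromBin p) ≡ p
bin-fromBin p = bin-foldl-pushBit p ℕ.≤-refl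

fromBin-injective : ∀ {p q} → fromBin p ≡ fromBin q → p ≡ q
fromBin-injective {p} {q} eq = trans (sym (bin-fromBin p)) (trans (cong bin eq) (bin-fromBin q))

fromBin-bin : ∀ {n} → 1 ≤ n → fromBin (bin n) ≡ n
fromBin-bin = go _ (<-wellFounded _)
  where
  go : ∀ n → Acc _<_ n → 1 ≤ n → fromBin (bin n) ≡ n
  go (suc zero)    _         _ = refl
  go (suc (suc m)) (acc rec) _ with pushBit-half (suc (suc m))
  ... | b , pushBit≡n = begin
    fromBin (bin n)                       ≡⟨ cong (fromBin ∘ bin) (sym pushBit≡n) ⟩
    fromBin (bin (pushBit (n / 2) b))     ≡⟨ cong fromBin (bin-pushBit b 1≤n/2) ⟩
    fromBin (bin (n / 2) ∷ʳ b)            ≡⟨ foldl-∷ʳ pushBit 1 b (bin (n / 2)) ⟩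
    pushBit (fromBin (bin (n / 2))) b     ≡⟨ cong (λ k → pushBit k b) (go (n / 2) (rec (m/n<m n 2 ℕ.≤-refl)) 1≤n/2) ⟩
    pushBit (n / 2) b                     ≡⟨ pushBit≡n ⟩
    n                                     ∎
    where
    open ≡-Reasoning
    n = suc (suc m)
    1≤n/2 : 1 ≤ n / 2
    1≤n/2 = m≥n⇒m/n>0 {n} (s≤s (s≤s z≤n))

foldl-pushBit-lower : ∀ n p → n ℕ.* 2 ^ length p ≤ foldl pushBit n p
foldl-pushBit-lower n []      = ℕ.≤-reflexive (ℕ.*-identityʳ n)
foldl-pushBit-lower n (b ∷ p) = begin
  n ℕ.* (2 ℕ.* 2 ^ length p)      ≡⟨ ℕ.*-assoc n 2 (2 ^ length p) ⟨
  n ℕ.* 2 ℕ.* 2 ^ length p        ≤⟨ ℕ.*-monoˡ-≤ (2 ^ length p) (*2≤pushBit n b) ⟩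
  pushBit n b ℕ.* 2 ^ length p    ≤⟨ foldl-pushBit-lower (pushBit n b) p ⟩
  foldl pushBit (pushBit n b) p   ∎
  where open ℕ.≤-Reasoning

foldl-pushBit-upper : ∀ n p → foldl pushBit n p < suc n ℕ.* 2 ^ length p
foldl-pushBit-upper n []      = ℕ.≤-reflexive (sym (ℕ.*-identityʳ (suc n)))
foldl-pushBit-upper n (b ∷ p) = begin-strict
  foldl pushBit (pushBit n b) p        <⟨ foldl-pushBit-upper (pushBit n b) p ⟩
  suc (pushBit n b) ℕ.* 2 ^ length p   ≤⟨ ℕ.*-monoˡ-≤ (2 ^ length p) (pushBit<*2 n b) ⟩
  suc n ℕ.* 2 ℕ.* 2 ^ length p         ≡⟨ ℕ.*-assoc (suc n) 2 (2 ^ length p) ⟩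
  suc n ℕ.* (2 ℕ.* 2 ^ length p)       ∎
  where open ℕ.≤-Reasoning

2^length≤fromBin : ∀ p → 2 ^ length p ≤ fromBin p
2^length≤fromBin p = ℕ.≤-trans (ℕ.≤-reflexive (sym (ℕ.*-identityˡ _))) (foldl-pushBit-lower 1 p)

fromBin<2^1+length : ∀ p → fromBin p < 2 ^ suc (length p)
fromBin<2^1+length = foldl-pushBit-upper 1

1≤fromBin : ∀ p → 1 ≤ fromBin p
1≤fromBin p = ℕ.≤-trans (ℕ.m^n>0 2 (length p)) (2^length≤fromBin p)

2^length-bin≤ : ∀ {n} → 1 ≤ n → 2 ^ length (bin n) ≤ n
2^length-bin≤ {n} 1≤n = subst (2 ^ length (bin n) ≤_) (fromBin-bin 1≤n) (2^length≤fromBin (bin n))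

inv≤pow½-length-bin : ∀ {n} → 1 ≤ n → inv n ℚ.≤ pow½ (length (bin n))
inv≤pow½-length-bin {n} 1≤n = inv≤pow½ n (length (bin n)) (2^length-bin≤ 1≤n)

pow½-length≤2inv-fromBin : ∀ p → pow½ (length p) ℚ.≤ inv (fromBin p) + inv (fromBin p)
pow½-length≤2inv-fromBin p = begin
  pow½ (length p)                               ≡⟨ pow½-halve (length p) ⟩
  pow½ (suc (length p)) + pow½ (suc (length p)) ≤⟨ ℚ.+-mono-≤ half≤inv half≤inv ⟩
  inv (fromBin p) + inv (fromBin p)             ∎
  where
  open ℚ.≤-Reasoning
  half≤inv : pow½ (suc (length p)) ℚ.≤ inv (fromBin p)
  half≤inv = pow½≤inv (fromBin p) (suc (length p)) (1≤fromBin p) (ℕ.<⇒≤ (fromBin<2^1+length p))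

Ω≤⇒ζ≤ : ∀ M q → Ω≤ M q → ζ≤ M q
Ω≤⇒ζ≤ M q Ω≤q ns (ns! , ns-good) = begin
  ζSum ns                              ≤⟨ sumℚ-map-mono (All.map (inv≤pow½-length-bin ∘ proj₁) ns-good) ⟩
  sumℚ (map (pow½ ∘ length ∘ bin) ns)  ≡⟨ cong sumℚ (map-∘ ns) ⟩
  ΩSum (map bin ns)                    ≤⟨ Ω≤q (map bin ns) (bins! , bins-halt) ⟩
  q                                    ∎
  where
  open ℚ.≤-Reasoning
  fromBin∘bin≡id : map fromBin (map bin ns) ≡ ns
  fromBin∘bin≡id = trans (sym (map-∘ ns)) (map-id-local (All.map (fromBin-bin ∘ proj₁) ns-good))
  bins! : Unique (map bin ns)
  bins! = Unique.map⁻ (subst Unique (sym fromBin∘bin≡id) ns!)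
  bins-halt : All (Halts M) (map bin ns)
  bins-halt = All.map⁺ (All.map proj₂ ns-good)

ζ≤⇒Ω≤ : ∀ M q → ζ≤ M q → Ω≤ M (q + q)
ζ≤⇒Ω≤ M q ζ≤q ps (ps! , ps-halt) = begin
  ΩSum ps
    ≤⟨ sumℚ-map-mono (All.tabulate {xs = ps} λ {p} _ → pow½-length≤2inv-fromBin p) ⟩
  sumℚ (map (λ p → inv (fromBin p) + inv (fromBin p)) ps)
    ≡⟨ sumℚ-map-+ (inv ∘ fromBin) (inv ∘ fromBin) ps ⟩
  sumℚ (map (inv ∘ fromBin) ps) + sumℚ (map (inv ∘ fromBin) ps)
    ≡⟨ cong (λ s → s + s) (cong sumℚ (map-∘ ps)) ⟩
  ζSum ns + ζSum ns
    ≤⟨ ℚ.+-mono-≤ ζns≤q ζns≤q ⟩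
  q + q ∎
  where
  open ℚ.≤-Reasoning
  ns = map fromBin ps
  good : ∀ {p} → Halts M p → 1 ≤ fromBin p × Halts M (bin (fromBin p))
  good {p} halts = 1≤fromBin p , subst (Halts M) (sym (bin-fromBin p)) halts
  ζns≤q : ζSum ns ℚ.≤ q
  ζns≤q = ζ≤q ns (Unique.map⁺ fromBin-injective ps! , All.map⁺ (All.map good ps-halt))

module _ (M : TM) where

  open TM M using (δ)
  open Config

  Trap : Fin (TM.states M) → Set
  Trap q = ∀ s → ∃ λ (write-move : Sym × Move) → δ q s ≡ just (q , write-move)

  step-halted : ∀ {c} → isHalted M c → step M c ≡ c
  step-halted halted rewrite halted = refl

  run-halted : ∀ {c} → isHalted M c → ∀ k → run M k c ≡ c
  run-halted halted zero    = refl
  run-halted halted (suc k) = trans (cong (run M k) (step-halted halted)) (run-halted halted k)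

  run-+ : ∀ j k c → run M (j ℕ.+ k) c ≡ run M k (run M j c)
  run-+ zero    k c = refl
  run-+ (suc j) k c = run-+ j k (step M c)

  step-trap : ∀ {q} → Trap q → ∀ {c} → state c ≡ q → state (step M c) ≡ q
  step-trap trap {c} refl with trap (head c)
  ... | _ , δ≡just rewrite δ≡just = refl

  run-trap : ∀ {q} → Trap q → ∀ k {c} → state c ≡ q → state (run M k c) ≡ q
  run-trap trap zero    c∈q = c∈q
  run-trap trap (suc k) c∈q = run-trap trap k (step-trap trap c∈q)

  trap-¬halted : ∀ {q} → Trap q → ∀ {c} → state c ≡ q → ¬ isHalted M c
  trap-¬halted trap {c} refl halted with trap (head c)
  ... | _ , δ≡just with () ← trans (sym halted) δ≡just

  run-comm : ∀ j k c → run M k (run M j c) ≡ run M j (run M k c)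
  run-comm j k c = begin
    run M k (run M j c)  ≡⟨ run-+ j k c ⟨
    run M (j ℕ.+ k) c    ≡⟨ cong (λ t → run M t c) (ℕ.+-comm j k) ⟩
    run M (k ℕ.+ j) c    ≡⟨ run-+ k j c ⟩
    run M j (run M k c)  ∎
    where open ≡-Reasoning

  trapped⇒¬Halts : ∀ {q} → Trap q → ∀ j {p} → state (run M j (initCfg M p)) ≡ q → ¬ Halts M p
  trapped⇒¬Halts trap j {p} trapped (k , halted) =
    trap-¬halted trap {run M k (run M j c)} (run-trap trap k trapped) still-halted
    where
    c = initCfg M p
    still-halted : isHalted M (run M k (run M j c))
    still-halted = subst (isHalted M) (sym (trans (run-comm j k c) (run-halted halted j))) halted

pattern qStart = zero
pattern qEnd   = suc zero
pattern qOne   = suc (suc zero)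
pattern qLoop  = suc (suc (suc zero))

tuataraδ : Fin 4 → Sym → Maybe (Fin 4 × Sym × Move)
tuataraδ qStart b0    = just (qEnd , b0 , R)
tuataraδ qStart b1    = just (qOne , b1 , R)
tuataraδ qOne   b0    = just (qEnd , b0 , R)
tuataraδ qEnd   blank = nothing
tuataraδ qOne   blank = nothing
tuataraδ _      _     = just (qLoop , blank , R)

tuatara : TM
tuatara = record { states = 4 ; start = qStart ; δ = tuataraδ }

tuatara-domain : List Str
tuatara-domain = (false ∷ []) ∷ (true ∷ []) ∷ (true ∷ false ∷ []) ∷ []

qLoop-trap : Trap tuatara qLoop
qLoop-trap _ = (blank , R) , refl

loops-after : ∀ j p → Config.state (run tuatara j (initCfg tuatara p)) ≡ qLoop → ¬ Halts tuatara p
loops-after j p = trapped⇒¬Halts tuatara qLoop-trap j {p}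

-- every input outside the domain reaches qLoop within three steps, checked by running the machine
tuatara-halts⇒∈domain : ∀ p → Halts tuatara p → p ∈ tuatara-domain
tuatara-halts⇒∈domain (false ∷ [])                  _ = here refl
tuatara-halts⇒∈domain (true ∷ [])                   _ = there (here refl)
tuatara-halts⇒∈domain (true ∷ false ∷ [])           _ = there (there (here refl))
tuatara-halts⇒∈domain p@[]                          h = ⊥-elim (loops-after 1 p refl h)
tuatara-halts⇒∈domain p@(false ∷ false ∷ _)         h = ⊥-elim (loops-after 2 p refl h)
tuatara-halts⇒∈domain p@(false ∷ true ∷ _)          h = ⊥-elim (loops-after 2 p refl h)
tuatara-halts⇒∈domain p@(true ∷ true ∷ _)           h = ⊥-elim (loops-after 2 p refl h)
tuatara-halts⇒∈domain p@(true ∷ false ∷ false ∷ _)  h = ⊥-elim (loops-after 3 p refl h)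
tuatara-halts⇒∈domain p@(true ∷ false ∷ true ∷ _)   h = ⊥-elim (loops-after 3 p refl h)

tuatara-ζ≤1 : Tuatara tuatara
tuatara-ζ≤1 ns (ns! , ns-good) = begin
  ζSum ns                            ≤⟨ sumℚ-map-⊆ inv-nonNegative ns! (All.map ∈domain ns-good) ⟩
  ζSum (map fromBin tuatara-domain)  ≡⟨⟩
  1ℚ                                 ∎
  where
  open ℚ.≤-Reasoning
  ∈domain : ∀ {n} → 1 ≤ n × Halts tuatara (bin n) → n ∈ map fromBin tuatara-domain
  ∈domain {n} (1≤n , halts) =
    subst (_∈ _) (fromBin-bin 1≤n) (∈-map⁺ fromBin (tuatara-halts⇒∈domain (bin n) halts))

tuatara-Ω>1 : Ω> tuatara 1ℚ
tuatara-Ω>1 = tuatara-domain , (domain! , (1 , refl) ∷ (1 , refl) ∷ (2 , refl) ∷ [])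
            , toWitness {a? = 1ℚ ℚ.<? ΩSum tuatara-domain} _
  where
  domain! : Unique tuatara-domain
  domain! = ((λ ()) ∷ (λ ()) ∷ []) ∷ ((λ ()) ∷ []) ∷ [] ∷ []

fact15 : ((M : TM) → (ζFinite M → ΩFinite M) × (ΩFinite M → ζFinite M))
         × ((M : TM) → Ω≤ M 1ℚ → ζ≤ M 1ℚ)
         × Σ TM (λ T → Tuatara T × Ω> T 1ℚ)
fact15 = (λ M → (λ (q , ζ≤q) → q + q , ζ≤⇒Ω≤ M q ζ≤q) , (λ (q , Ω≤q) → q , Ω≤⇒ζ≤ M q Ω≤q))
       , (λ M → Ω≤⇒ζ≤ M 1ℚ)
       , tuatara , tuatara-ζ≤1 , tuatara-Ω>1
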